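{- $\mathrm{HS}$ is both bicomplete and bicomplete modulo expressive power for pairs that are down-set incompatible on either side.
   Context: $\mathrm{HS}$: $\phi ::= p \mid \bot \mid \neg\phi \mid \phi\,\dot\wedge\,\phi \mid \phi\,\dot\vee\,\phi \mid \mathsf{M}\phi$ on propositional teams. Support: $s\models p$ iff all $w\in s$ make $p$ true; $s\models\bot$ iff $s=\emptyset$; $s\models\neg\phi$ iff $s\models^-\phi$ (anti-support); $\dot\wedge$ supported iff both are; $s\models\phi\,\dot\vee\,\psi$ iff $s=t\cup u$ with $t\models\phi,u\models\psi$; $s\models\mathsf{M}\phi$ iff not $s\models^-\phi$. Anti-support: $s\models^-\neg\phi$ iff $s\models\phi$; otherwise $s\models^-\phi$ iff every $t\subseteq s$ with $t\models\phi$ is empty. A pair of team properties $(\mathcal{P},\mathcal{Q})$ is down-set incompatible on either side if either [$s\in\mathcal{Q}$ iff every $t\subseteq s$ with $t\in\mathcal{P}$ is empty] or the same with $\mathcal{P},\mathcal{Q}$ swapped. $L$ is bicomplete for a class $\mathscr{P}$ of pairs if for every finite $\mathsf{X}$, $\{(\|\phi\|_\mathsf{X},\|\neg\phi\|_\mathsf{X})\mid\phi\in L\}$ equals the pairs of $\mathscr{P}$ over $\mathsf{X}$ (where $\|\phi\|_\mathsf{X}$ is the set of teams over $\mathsf{X}$ supporting $\phi$); bicomplete modulo expressive power if bicomplete for $\mathscr{P}$ restricted to pairs of properties expressible in $L$. -}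

module Defs where

open import Data.Nat using (ℕ; zero; suc)
open import Data.Bool using (Bool; true; false; if_then_else_; _∨_)
open import Data.Fin using (Fin)
open import Data.Vec using (Vec; []; _∷_; lookup)
open import Data.Product using (Σ; _×_; _,_; ∃-syntax)
open import Data.Sum using (_⊎_)
open import Relation.Nullary using (¬_)
open import Relation.Binary.PropositionalEquality using (_≡_)
open import Function.Bundles using (_⇔_)

Valuation : ℕ → Set
Valuation n = Vec Bool n

-- A team over n variables: a set of valuations, encoded canonically as
-- its characteristic table (a complete binary tree of depth n), so that
-- propositional equality of teams is extensional equality of sets.
Team : ℕ → Set
Team zero    = Bool
Team (suc n) = Team n × Team n

member : ∀ {n} → Valuation n → Team n → Bool
member {zero}  []      b       = b
member {suc n} (b ∷ w) (l , r) = member w (if b then r else l)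

_∈T_ : ∀ {n} → Valuation n → Team n → Set
w ∈T s = member w s ≡ true

_⊆T_ : ∀ {n} → Team n → Team n → Set
t ⊆T s = ∀ w → w ∈T t → w ∈T s

IsEmpty : ∀ {n} → Team n → Set
IsEmpty s = ∀ w → member w s ≡ false

_∪T_ : ∀ {n} → Team n → Team n → Team n
_∪T_ {zero}  a b             = a ∨ b
_∪T_ {suc n} (l , r) (l' , r') = (l ∪T l') , (r ∪T r')

data Form (n : ℕ) : Set where
  atom : Fin n → Form n
  ⊥'   : Form n
  ¬'_  : Form n → Form n
  _∧̇_  : Form n → Form n → Form n
  _∨̇_  : Form n → Form n → Form n
  M    : Form n → Form n

infix 4 _⊨_ _⊨⁻_

mutual
  _⊨_ : ∀ {n} → Team n → Form n → Set
  s ⊨ atom i  = ∀ w → w ∈T s → lookup w i ≡ true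
  s ⊨ ⊥'      = IsEmpty s
  s ⊨ (¬' φ)  = s ⊨⁻ φ
  s ⊨ (φ ∧̇ ψ) = (s ⊨ φ) × (s ⊨ ψ)
  s ⊨ (φ ∨̇ ψ) = Σ (Team _) λ t → Σ (Team _) λ u → (s ≡ (t ∪T u)) × (t ⊨ φ) × (u ⊨ ψ)
  s ⊨ M φ     = ¬ (s ⊨⁻ φ)

  _⊨⁻_ : ∀ {n} → Team n → Form n → Set
  s ⊨⁻ (¬' φ)  = s ⊨ φ
  s ⊨⁻ atom i  = ∀ t → t ⊆T s → t ⊨ atom i → IsEmpty t
  s ⊨⁻ ⊥'      = ∀ t → t ⊆T s → t ⊨ ⊥' → IsEmpty t
  s ⊨⁻ (φ ∧̇ ψ) = ∀ t → t ⊆T s → t ⊨ (φ ∧̇ ψ) → IsEmpty t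
  s ⊨⁻ (φ ∨̇ ψ) = ∀ t → t ⊆T s → t ⊨ (φ ∨̇ ψ) → IsEmpty t
  s ⊨⁻ M φ     = ∀ t → t ⊆T s → t ⊨ M φ → IsEmpty t

Property : ℕ → Set
Property n = Team n → Bool

_∈P_ : ∀ {n} → Team n → Property n → Set
s ∈P P = P s ≡ true

Expresses : ∀ {n} → Form n → Property n → Set
Expresses φ P = ∀ s → (s ∈P P) ⇔ (s ⊨ φ)

Expressible : ∀ {n} → Property n → Set
Expressible {n} P = Σ (Form n) λ φ → Expresses φ P

DownSetIncomp : ∀ {n} → Property n → Property n → Set
DownSetIncomp {n} P Q =
  ∀ s → (s ∈P Q) ⇔ (∀ (t : Team n) → t ⊆T s → t ∈P P → IsEmpty t)

DownSetIncompEitherSide : ∀ {n} → Property n → Property n → Set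
DownSetIncompEitherSide P Q = DownSetIncomp P Q ⊎ DownSetIncomp Q P

PairClass : Set₁
PairClass = ∀ {n} → Property n → Property n → Set

IsPairOf : ∀ {n} → Form n → Property n → Property n → Set
IsPairOf φ P Q = Expresses φ P × Expresses (¬' φ) Q

Bicomplete : PairClass → Set
Bicomplete 𝒞 = ∀ n →
    (∀ (φ : Form n) → Σ (Property n) λ P → Σ (Property n) λ Q → 𝒞 P Q × IsPairOf φ P Q)
  × (∀ (P Q : Property n) → 𝒞 P Q → Σ (Form n) λ φ → IsPairOf φ P Q)

RestrictExpressible : PairClass → PairClass
RestrictExpressible 𝒞 P Q = 𝒞 P Q × Expressible P × Expressible Q

BicompleteModExpr : PairClass → Set
BicompleteModExpr 𝒞 = Bicomplete (RestrictExpressible 𝒞)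

{-# OPTIONS --safe #-}
-- For φ not a negation, the support of ¬ φ is by definition the down-set
-- complement of the support of φ, while ¬ ¬ ψ is supported exactly where ψ is;
-- stripping negations therefore shows that every pair (‖φ‖, ‖¬φ‖) is down-set
-- incompatible on one side.  Conversely HS is expressively complete: with χ_w
-- the conjunction of the literals true at w, M χ_w and ¬ χ_w say w ∈ s and
-- w ∉ s, a conjunction of these pins down a team T, M ¬ (that) says s ≠ T, and
-- P is expressed by the conjunction φ_P of "s ≠ T" over all T ∉ P.  Being a
-- conjunction, φ_P realises every pair incompatible on the left, and ¬ φ_Q every
-- pair incompatible on the right.  Bicompleteness modulo expressive power then
-- follows for any class, as the pairs given by formulas are pairs of expressible
-- properties.
module Submission where

open import Defs
open import Data.Bool using (Bool; true; false; if_then_else_)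
import Data.Bool as Bool
open import Data.Bool.Properties using (¬-not; not-¬)
open import Data.Empty using (⊥-elim)
open import Data.Fin using (Fin)
open import Data.List using (List; []; _∷_; [_]; foldr; allFin; cartesianProduct; cartesianProductWith)
open import Data.List.Membership.Propositional using (lose)
open import Data.List.Membership.Propositional.Properties
  using (∈-allFin; ∈-cartesianProduct⁺; ∈-cartesianProductWith⁺)
open import Data.List.Relation.Unary.All as All using (All; []; _∷_; all?)
open import Data.List.Relation.Unary.Any as Any using (Any; any?; here; there)
open import Data.List.Relation.Unary.Enumerates.Setoid using (IsEnumeration)
open import Data.Nat using (ℕ; zero; suc)
open import Data.Product as × using (∃; _×_; _,_; proj₁; proj₂)
import Data.Product.Properties as ×
open import Data.Sum as ⊎ using (inj₁; inj₂)
open import Data.Vec using (Vec; []; _∷_; lookup)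
import Data.Vec.Properties as Vec
open import Data.Vec.Relation.Binary.Pointwise.Extensional using (ext; Pointwise-≡⇒≡)
open import Function.Base using (_∘_)
open import Function.Bundles using (_⇔_; mk⇔; Equivalence)
open import Function.Construct.Composition using (_⇔-∘_)
open import Function.Construct.Identity using (⇔-id)
open import Function.Construct.Symmetry using (⇔-sym)
open import Relation.Binary.Definitions using (DecidableEquality)
open import Relation.Binary.PropositionalEquality using (_≡_; _≢_; refl; sym; cong; cong₂; subst; setoid)
open import Relation.Nullary using (¬_; Dec; yes; no; does)
open import Relation.Nullary.Decidable as Dec using (_×-dec_; _→-dec_; ¬?)
open import Relation.Unary using (Decidable)

open Equivalence

private
  variable
    n : ℕ
    A : Set
    P Q : Property n

record Enumerable (A : Set) : Set where
  field
    elements : List A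
    complete : IsEnumeration (setoid A) elements

open Enumerable

enumerable-Bool : Enumerable Bool
enumerable-Bool = record
  { elements = false ∷ true ∷ []
  ; complete = λ { false → here refl ; true → there (here refl) }
  }

enumerable-× : ∀ {B : Set} → Enumerable A → Enumerable B → Enumerable (A × B)
enumerable-× eA eB = record
  { elements = cartesianProduct (elements eA) (elements eB)
  ; complete = λ (x , y) → ∈-cartesianProduct⁺ (complete eA x) (complete eB y)
  }

enumerable-Vec : Enumerable A → ∀ n → Enumerable (Vec A n)
enumerable-Vec eA zero = record
  { elements = [ [] ]
  ; complete = λ { [] → here refl }
  }
enumerable-Vec eA (suc n) = record
  { elements = cartesianProductWith _∷_ (elements eA) (elements (enumerable-Vec eA n))
  ; complete = λ { (x ∷ xs) →
      ∈-cartesianProductWith⁺ _∷_ (complete eA x) (complete (enumerable-Vec eA n) xs) }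
  }

enumerable-Fin : ∀ n → Enumerable (Fin n)
enumerable-Fin n = record { elements = allFin n ; complete = ∈-allFin }

enumerable-Valuation : ∀ n → Enumerable (Valuation n)
enumerable-Valuation = enumerable-Vec enumerable-Bool

enumerable-Team : ∀ n → Enumerable (Team n)
enumerable-Team zero    = enumerable-Bool
enumerable-Team (suc n) = enumerable-× (enumerable-Team n) (enumerable-Team n)

module _ (eA : Enumerable A) {P : A → Set} where

  All-elements⇔∀ : All P (elements eA) ⇔ (∀ x → P x)
  All-elements⇔∀ = mk⇔ (λ ps x → All.lookup ps (complete eA x)) (λ ps → All.tabulate (λ {x} _ → ps x))

  Any-elements⇔∃ : Any P (elements eA) ⇔ ∃ P
  Any-elements⇔∃ = mk⇔ Any.satisfied (λ (x , px) → lose (complete eA x) px)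

  ∀? : Decidable P → Dec (∀ x → P x)
  ∀? P? = Dec.map All-elements⇔∀ (all? P? (elements eA))

  ∃? : Decidable P → Dec (∃ P)
  ∃? P? = Dec.map Any-elements⇔∃ (any? P? (elements eA))

does≡true⇔ : (a? : Dec A) → (does a? ≡ true) ⇔ A
does≡true⇔ (yes a)  = mk⇔ (λ _ → a) (λ _ → refl)
does≡true⇔ (no ¬a) = mk⇔ (λ ()) (⊥-elim ∘ ¬a)

tabulateT : (Valuation n → Bool) → Team n
tabulateT {zero}  f = f []
tabulateT {suc n} f = tabulateT (f ∘ (false ∷_)) , tabulateT (f ∘ (true ∷_))

member-tabulateT : (f : Valuation n → Bool) (w : Valuation n) → member w (tabulateT f) ≡ f w
member-tabulateT f []          = refl
member-tabulateT f (false ∷ w) = member-tabulateT (f ∘ (false ∷_)) w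
member-tabulateT f (true ∷ w)  = member-tabulateT (f ∘ (true ∷_)) w

team-ext : (s t : Team n) → (∀ w → member w s ≡ member w t) → s ≡ t
team-ext {zero}  s t s≗t = s≗t []
team-ext {suc n} (l , r) (l′ , r′) s≗t =
  cong₂ _,_ (team-ext l l′ (s≗t ∘ (false ∷_))) (team-ext r r′ (s≗t ∘ (true ∷_)))

_≟T_ : DecidableEquality (Team n)
_≟T_ {zero}  = Bool._≟_
_≟T_ {suc n} = ×.≡-dec _≟T_ _≟T_

∈T⇒nonempty : ∀ {w} {s : Team n} → w ∈T s → ¬ IsEmpty s
∈T⇒nonempty w∈s s-empty = not-¬ w∈s (s-empty _)

_≟V_ : DecidableEquality (Valuation n)
_≟V_ = Vec.≡-dec Bool._≟_

singleton : Valuation n → Team n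
singleton v = tabulateT (λ u → does (u ≟V v))

∈T-singleton : ∀ {u v : Valuation n} → u ∈T singleton v ⇔ u ≡ v
∈T-singleton {u = u} {v} rewrite member-tabulateT (λ u → does (u ≟V v)) u = does≡true⇔ (u ≟V v)

singleton-⊆ : ∀ {v} {s : Team n} → v ∈T s → singleton v ⊆T s
singleton-⊆ {s = s} v∈s u u∈sv = subst (_∈T s) (sym (to ∈T-singleton u∈sv)) v∈s

DownComplement : (Team n → Set) → Team n → Set
DownComplement {n} 𝒜 s = ∀ (t : Team n) → t ⊆T s → 𝒜 t → IsEmpty t

downComplement-cong : ∀ {𝒜 ℬ : Team n → Set} → (∀ t → 𝒜 t ⇔ ℬ t) →
                      ∀ s → DownComplement 𝒜 s ⇔ DownComplement ℬ s
downComplement-cong 𝒜⇔ℬ s = mk⇔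
  (λ h t t⊆s ℬt → h t t⊆s (from (𝒜⇔ℬ t) ℬt))
  (λ h t t⊆s 𝒜t → h t t⊆s (to (𝒜⇔ℬ t) 𝒜t))

Flat : (Team n → Set) → (Valuation n → Set) → Set
Flat 𝒜 a = ∀ s → 𝒜 s ⇔ (∀ v → v ∈T s → a v)

flat-resp : ∀ {𝒜 : Team n → Set} {a b : Valuation n → Set} →
            (∀ v → a v ⇔ b v) → Flat 𝒜 a → Flat 𝒜 b
flat-resp a⇔b 𝒜-flat s = mk⇔
  (λ 𝒜s v v∈s → to (a⇔b v) (to (𝒜-flat s) 𝒜s v v∈s))
  (λ h → from (𝒜-flat s) (λ v v∈s → from (a⇔b v) (h v v∈s)))

flat-downComplement : ∀ {𝒜 : Team n → Set} {a : Valuation n → Set} →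
                      Flat 𝒜 a → Flat (DownComplement 𝒜) (¬_ ∘ a)
flat-downComplement {𝒜 = 𝒜} {a} 𝒜-flat s = mk⇔ excludes includes-none
  where
  excludes : DownComplement 𝒜 s → ∀ v → v ∈T s → ¬ a v
  excludes h v v∈s av = ∈T⇒nonempty (from (∈T-singleton {u = v}) refl)
    (h (singleton v) (singleton-⊆ v∈s)
       (from (𝒜-flat (singleton v)) (λ u u∈sv → subst a (sym (to ∈T-singleton u∈sv)) av)))

  includes-none : (∀ v → v ∈T s → ¬ a v) → DownComplement 𝒜 s
  includes-none h t t⊆s 𝒜t w = ¬-not (λ w∈t → h w (t⊆s w w∈t) (to (𝒜-flat t) 𝒜t w w∈t))

⊤ : Form n
⊤ = ¬' ⊥'

⊨⊤ : ∀ {s : Team n} → s ⊨ ⊤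
⊨⊤ _ _ t-empty = t-empty

-- The leading ⊤ makes ⋀ e f a conjunction even for empty A, so that
-- s ⊨ ¬' ⋀ e f unfolds to DownComplement (_⊨ ⋀ e f) s.
⋀ : Enumerable A → (A → Form n) → Form n
⋀ eA f = ⊤ ∧̇ foldr (λ x → f x ∧̇_) ⊤ (elements eA)

⊨-⋀ : ∀ (eA : Enumerable A) {f : A → Form n} {s} → s ⊨ ⋀ eA f ⇔ (∀ x → s ⊨ f x)
⊨-⋀ eA {f} {s} =
  All-elements⇔∀ eA ⇔-∘ mk⇔ (⊨-foldr⇒All _ ∘ proj₂) (λ fs → ⊨⊤ , All⇒⊨-foldr fs)
  where
  ⊨-foldr⇒All : ∀ xs → s ⊨ foldr (λ x → f x ∧̇_) ⊤ xs → All (λ x → s ⊨ f x) xs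
  ⊨-foldr⇒All []       _          = []
  ⊨-foldr⇒All (x ∷ xs) (fx , fxs) = fx ∷ ⊨-foldr⇒All xs fxs

  All⇒⊨-foldr : ∀ {xs} → All (λ x → s ⊨ f x) xs → s ⊨ foldr (λ x → f x ∧̇_) ⊤ xs
  All⇒⊨-foldr []         = ⊨⊤
  All⇒⊨-foldr (fx ∷ fxs) = fx , All⇒⊨-foldr fxs

literal : Bool → Fin n → Form n
literal true  i = atom i
literal false i = ¬' atom i

flat-literal : ∀ b (i : Fin n) → Flat (_⊨ literal b i) (λ v → lookup v i ≡ b)
flat-literal true  i s = ⇔-id _
flat-literal false i   = flat-resp (λ _ → mk⇔ ¬-not not-¬) (flat-downComplement (λ _ → ⇔-id _))

χ : Valuation n → Form n
χ w = ⋀ (enumerable-Fin _) (λ i → literal (lookup w i) i)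

flat-χ : (w : Valuation n) → Flat (_⊨ χ w) (_≡ w)
flat-χ w s = mk⇔
  (λ s⊨χ v v∈s → Pointwise-≡⇒≡ (ext λ i →
     to (flat-literal _ i s) (to (⊨-⋀ (enumerable-Fin _)) s⊨χ i) v v∈s))
  (λ s⊆w → from (⊨-⋀ (enumerable-Fin _)) λ i →
     from (flat-literal _ i s) λ v v∈s → cong (λ u → lookup u i) (s⊆w v v∈s))

⊨¬χ⇔∉ : ∀ {w} {s : Team n} → s ⊨ ¬' χ w ⇔ member w s ≡ false
⊨¬χ⇔∉ {w = w} {s} =
  mk⇔ (λ s≢w → ¬-not (λ w∈s → s≢w w w∈s refl)) (λ w∉s v v∈s → λ { refl → not-¬ v∈s w∉s })
  ⇔-∘ flat-downComplement (flat-χ w) s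

⊨Mχ⇔∈ : ∀ {w} {s : Team n} → s ⊨ M (χ w) ⇔ w ∈T s
⊨Mχ⇔∈ = mk⇔
  (λ s⊭¬χ → ¬-not (s⊭¬χ ∘ from ⊨¬χ⇔∉))
  (λ w∈s → not-¬ w∈s ∘ to ⊨¬χ⇔∉)

memberFormula : Bool → Valuation n → Form n
memberFormula true  w = M (χ w)
memberFormula false w = ¬' χ w

⊨memberFormula : ∀ b {w} {s : Team n} → s ⊨ memberFormula b w ⇔ member w s ≡ b
⊨memberFormula true  = ⊨Mχ⇔∈
⊨memberFormula false = ⊨¬χ⇔∉

teamFormula : Team n → Form n
teamFormula T = ⋀ (enumerable-Valuation _) (λ w → memberFormula (member w T) w)

⊨teamFormula⇔≡ : ∀ {s T : Team n} → s ⊨ teamFormula T ⇔ s ≡ T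
⊨teamFormula⇔≡ {n} {s} {T} = mk⇔
  (λ s⊨T → team-ext s T λ w → to (⊨memberFormula _) (to (⊨-⋀ (enumerable-Valuation _)) s⊨T w))
  (λ { refl → from (⊨-⋀ (enumerable-Valuation n)) λ w → from (⊨memberFormula _ {w} {s}) refl })

avoid : Team n → Form n
avoid T = M (¬' teamFormula T)

⊨avoid⇔≢ : ∀ {s T : Team n} → s ⊨ avoid T ⇔ s ≢ T
⊨avoid⇔≢ = mk⇔ (_∘ from ⊨teamFormula⇔≡) (_∘ to ⊨teamFormula⇔≡)

express : Property n → Form n
express P = ⋀ (enumerable-Team _) (λ T → if P T then ⊤ else avoid T)

expresses-express : (P : Property n) → Expresses (express P) P
expresses-express P s = mk⇔
  (λ s∈P → from (⊨-⋀ (enumerable-Team _)) (admits s∈P))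
  (λ s⊨P → excluded-only-by-avoid (P s) (to (⊨-⋀ (enumerable-Team _)) s⊨P s))
  where
  admits : s ∈P P → ∀ T → s ⊨ (if P T then ⊤ else avoid T)
  admits s∈P T with P T in T∈P
  ... | true  = ⊨⊤
  ... | false = from ⊨avoid⇔≢ λ { refl → not-¬ s∈P T∈P }

  excluded-only-by-avoid : ∀ b → s ⊨ (if b then ⊤ else avoid s) → b ≡ true
  excluded-only-by-avoid true  _        = refl
  excluded-only-by-avoid false s⊨avoid = ⊥-elim (to ⊨avoid⇔≢ s⊨avoid refl)

_⊆T?_ : (t s : Team n) → Dec (t ⊆T s)
t ⊆T? s = ∀? (enumerable-Valuation _) λ w → (member w t Bool.≟ true) →-dec (member w s Bool.≟ true)

isEmpty? : (s : Team n) → Dec (IsEmpty s)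
isEmpty? s = ∀? (enumerable-Valuation _) λ w → member w s Bool.≟ false

downComplement? : ∀ {𝒜 : Team n → Set} → Decidable 𝒜 → Decidable (DownComplement 𝒜)
downComplement? 𝒜? s = ∀? (enumerable-Team _) λ t → t ⊆T? s →-dec (𝒜? t →-dec isEmpty? t)

infix 4 _⊨?_ _⊨⁻?_

mutual
  _⊨?_ : (s : Team n) (φ : Form n) → Dec (s ⊨ φ)
  s ⊨? atom i  = ∀? (enumerable-Valuation _) λ w →
                   (member w s Bool.≟ true) →-dec (lookup w i Bool.≟ true)
  s ⊨? ⊥'      = isEmpty? s
  s ⊨? (¬' φ)  = s ⊨⁻? φ
  s ⊨? (φ ∧̇ ψ) = (s ⊨? φ) ×-dec (s ⊨? ψ)
  s ⊨? (φ ∨̇ ψ) = ∃? (enumerable-Team _) λ t → ∃? (enumerable-Team _) λ u →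
                   (s ≟T (t ∪T u)) ×-dec (t ⊨? φ) ×-dec (u ⊨? ψ)
  s ⊨? M φ     = ¬? (s ⊨⁻? φ)

  _⊨⁻?_ : (s : Team n) (φ : Form n) → Dec (s ⊨⁻ φ)
  s ⊨⁻? (¬' φ)  = s ⊨? φ
  s ⊨⁻? atom i  = downComplement? (_⊨? atom i) s
  s ⊨⁻? ⊥'      = downComplement? (_⊨? ⊥') s
  s ⊨⁻? (φ ∧̇ ψ) = downComplement? (_⊨? (φ ∧̇ ψ)) s
  s ⊨⁻? (φ ∨̇ ψ) = downComplement? (_⊨? (φ ∨̇ ψ)) s
  s ⊨⁻? M φ     = downComplement? (_⊨? M φ) s

‖_‖ : Form n → Property n
‖ φ ‖ s = does (s ⊨? φ)

‖‖-isPairOf : (φ : Form n) → IsPairOf φ ‖ φ ‖ ‖ ¬' φ ‖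
‖‖-isPairOf φ = (λ s → does≡true⇔ (s ⊨? φ)) , (λ s → does≡true⇔ (s ⊨? ¬' φ))

downSetIncomp⇔downComplement : (φ : Form n) → Expresses φ P →
                               DownSetIncomp P Q ⇔ (∀ s → (s ∈P Q) ⇔ DownComplement (_⊨ φ) s)
downSetIncomp⇔downComplement φ φ-P = mk⇔
  (λ P-Q s → ⇔-sym (φ⇔P s) ⇔-∘ P-Q s)
  (λ Q-φ s → φ⇔P s ⇔-∘ Q-φ s)
  where
  φ⇔P = downComplement-cong (⇔-sym ∘ φ-P)

-- For φ not a negation, s ⊨ ¬' φ unfolds to DownComplement (_⊨ φ) s; since
-- ¬' ¬' ψ has the support of ψ, IsPairOf (¬' ψ) P Q is IsPairOf ψ Q P swapped.
isPairOf⇒downSetIncomp : (φ : Form n) → IsPairOf φ P Q → DownSetIncompEitherSide P Q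
isPairOf⇒downSetIncomp (¬' ψ)     pair         = ⊎.swap (isPairOf⇒downSetIncomp ψ (×.swap pair))
isPairOf⇒downSetIncomp φ@(atom _) (φ-P , ¬φ-Q) = inj₁ (from (downSetIncomp⇔downComplement φ φ-P) ¬φ-Q)
isPairOf⇒downSetIncomp φ@⊥'       (φ-P , ¬φ-Q) = inj₁ (from (downSetIncomp⇔downComplement φ φ-P) ¬φ-Q)
isPairOf⇒downSetIncomp φ@(_ ∧̇ _)  (φ-P , ¬φ-Q) = inj₁ (from (downSetIncomp⇔downComplement φ φ-P) ¬φ-Q)
isPairOf⇒downSetIncomp φ@(_ ∨̇ _)  (φ-P , ¬φ-Q) = inj₁ (from (downSetIncomp⇔downComplement φ φ-P) ¬φ-Q)
isPairOf⇒downSetIncomp φ@(M _)    (φ-P , ¬φ-Q) = inj₁ (from (downSetIncomp⇔downComplement φ φ-P) ¬φ-Q)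

downSetIncomp⇒isPairOf-express : (P : Property n) → DownSetIncomp P Q → IsPairOf (express P) P Q
downSetIncomp⇒isPairOf-express P P-Q =
  expresses-express P , to (downSetIncomp⇔downComplement (express P) (expresses-express P)) P-Q

downSetIncomp⇒isPairOf : (P Q : Property n) → DownSetIncompEitherSide P Q → ∃ λ φ → IsPairOf φ P Q
downSetIncomp⇒isPairOf P Q (inj₁ P-Q) = express P , downSetIncomp⇒isPairOf-express P P-Q
downSetIncomp⇒isPairOf P Q (inj₂ Q-P) = ¬' express Q , ×.swap (downSetIncomp⇒isPairOf-express Q Q-P)

bicomplete : Bicomplete DownSetIncompEitherSide
bicomplete n =
  (λ φ → ‖ φ ‖ , ‖ ¬' φ ‖ , isPairOf⇒downSetIncomp φ (‖‖-isPairOf φ) , ‖‖-isPairOf φ) ,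
  downSetIncomp⇒isPairOf

bicomplete⇒bicompleteModExpr : ∀ {𝒞 : PairClass} → Bicomplete 𝒞 → BicompleteModExpr 𝒞
bicomplete⇒bicompleteModExpr bicomplete-𝒞 n =
  (λ φ → let (P , Q , P-Q , φ-P , ¬φ-Q) = proj₁ (bicomplete-𝒞 n) φ
         in P , Q , (P-Q , (φ , φ-P) , (¬' φ , ¬φ-Q)) , φ-P , ¬φ-Q) ,
  (λ P Q (P-Q , _) → proj₂ (bicomplete-𝒞 n) P Q P-Q)

corollary3p12 : Bicomplete DownSetIncompEitherSide × BicompleteModExpr DownSetIncompEitherSide
corollary3p12 = bicomplete , bicomplete⇒bicompleteModExpr bicomplete
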